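{- Let $N$ be a chemical reaction network. If $y\to y'$ is a reaction of $N$ that is reversible (i.e. $y'\to y$ is also a reaction of $N$), then none of the vertices of $\mathcal H_N$ corresponding to $y$ or $y'$ in the reaction $y\to y'$ or in the reaction $y'\to y$ is almost balanced.
   Context: A chemical reaction network $N=(\mathscr S,\mathscr C,\mathscr R)$ consists of a finite set of species $\mathscr S$, complexes $\mathscr C\subseteq\mathbb Z_{\ge0}^{\mathscr S}$, and reactions $y\to y'$ with $y\ne y'$; every complex occurs in some reaction, every species lies in some complex's support, and there are no reactions $\varnothing\to y$. Reactions are indexed $1,\dots,m$, the $i$-th written $y_i\to y_i'$. The network hypergraph $\mathcal H_N$ has $2m$ vertices $u_1,v_1,\dots,u_m,v_m$ ($u_i$ corresponds to the reactant $y_i$ of reaction $i$, $v_i$ to its product $y_i'$). Hyperedges: for each species $s$, $E_s=\{u_i: s\in\mathrm{supp}(y_i)\}\cup\{v_i: s\in\mathrm{supp}(y_i')\}$; for each reaction $i$, $E_i=\{u_i,v_i\}$ if $y_i'\ne\varnothing$ and $E_i=\varnothing$ otherwise. A vertex $w$ is almost balanced if there is a multiset $\mathscr E$ of edges (nonnegative multiplicities) and a splitting $\mathscr E=\mathscr E_r\sqcup\mathscr E_b$ into two submultisets whose multiplicities add up, such that, writing $\deg_{\mathscr E_c}(z)$ for the number of edges of $\mathscr E_c$ (with multiplicity) containing $z$, $\deg_{\mathscr E_r}(w)=\deg_{\mathscr E_b}(w)+k$ for some positive integer $k$ and $\deg_{\mathscr E_r}(z)=\deg_{\mathscr E_b}(z)$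 for every other vertex $z$. -}

module Defs where

open import Data.Nat using (ℕ; zero; suc; _+_; _<_)
open import Data.Nat.Properties using (_≟_)
open import Data.Fin using (Fin; zero; suc)
open import Data.Vec using (Vec; lookup; replicate)
open import Data.Vec.Properties using (≡-dec)
open import Data.Bool using (Bool; true; false; if_then_else_; _∧_; not)
open import Data.Product using (Σ; _×_; _,_; ∃)
open import Data.Sum using (_⊎_)
open import Relation.Nullary using (¬_; does)
open import Relation.Binary.PropositionalEquality using (_≡_; _≢_)

-- Species are Fin n, reactions are indexed by Fin m.
-- A complex is a vector in ℕ^n (Vec ℕ n).
Complex : ℕ → Set
Complex n = Vec ℕ n

∅c : (n : ℕ) → Complex n
∅c n = replicate n 0

record CRN (n m : ℕ) : Set where
  field
    reactant : Fin m → Complex n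
    product  : Fin m → Complex n

-- Standing assumptions of a chemical reaction network.  The complexes are
-- those occurring in reactions (so "every complex occurs in a reaction" holds
-- by construction).
record IsCRN {n m : ℕ} (N : CRN n m) : Set where
  open CRN N
  field
    nonTrivial   : ∀ i → reactant i ≢ product i
    noInflow     : ∀ i → reactant i ≢ ∅c n
    distinct     : ∀ i j → reactant i ≡ reactant j → product i ≡ product j → i ≡ j
    speciesUsed  : ∀ (s : Fin n) → ∃ λ i → (lookup (reactant i) s ≢ 0) ⊎ (lookup (product i) s ≢ 0)

ΣFin : (k : ℕ) → (Fin k → ℕ) → ℕ
ΣFin zero    f = 0
ΣFin (suc k) f = f zero + ΣFin k (λ i → f (suc i))

-- Vertices of the hypergraph: u_i (reactant side) and v_i (product side).
data Side : Set where
  U V : Side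

Vertex : ℕ → Set
Vertex m = Fin m × Side

-- Hyperedges: E_s for species s, E_i for reaction i.
Edge : ℕ → ℕ → Set
Edge n m = Fin n ⊎ Fin m

inSupp : {n : ℕ} → Complex n → Fin n → Bool
inSupp y s = not (does (lookup y s ≟ 0))

isEmptyComplex : {n : ℕ} → Complex n → Bool
isEmptyComplex {n} y = does (≡-dec _≟_ y (∅c n))

memberSpecies : {n m : ℕ} → CRN n m → Fin n → Vertex m → Bool
memberSpecies N s (i , U) = inSupp (CRN.reactant N i) s
memberSpecies N s (i , V) = inSupp (CRN.product N i) s

memberReaction : {n m : ℕ} → CRN n m → Fin m → Vertex m → Bool
memberReaction N j (i , _) = does (i Data.Fin.≟ j) ∧ not (isEmptyComplex (CRN.product N j))

member : {n m : ℕ} → CRN n m → Edge n m → Vertex m → Bool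
member N (Data.Sum.inj₁ s) z = memberSpecies N s z
member N (Data.Sum.inj₂ j) z = memberReaction N j z

-- Degree of z in the multiset of edges with multiplicities c.
deg : {n m : ℕ} → (N : CRN n m) → (Edge n m → ℕ) → Vertex m → ℕ
deg {n} {m} N c z =
  ΣFin n (λ s → if member N (Data.Sum.inj₁ s) z then c (Data.Sum.inj₁ s) else 0)
  + ΣFin m (λ j → if member N (Data.Sum.inj₂ j) z then c (Data.Sum.inj₂ j) else 0)

AlmostBalanced : {n m : ℕ} → CRN n m → Vertex m → Set
AlmostBalanced {n} {m} N w =
  Σ (Edge n m → ℕ) λ r → Σ (Edge n m → ℕ) λ b → Σ ℕ λ k →
    (0 < k) × (deg N r w ≡ deg N b w + k) × (∀ z → z ≢ w → deg N r z ≡ deg N b z)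

-- A reaction edge contains u_i exactly when it contains v_i, and a species
-- edge only sees the complex at a vertex.  For a reversible pair
-- y → y' (reaction i) and y' → y (reaction j), the vertices u_i, v_j carry y
-- and u_j, v_i carry y', so for every multiset of edges
--   deg u_i + deg u_j = deg v_i + deg v_j.
-- Applied to the red and the blue multiset, this relation forces the excess k
-- at an almost balanced vertex among the four to vanish.
module Submission where

open import Defs
open import Data.Nat using (ℕ; _+_; s≤s)
open import Data.Nat.Properties using (+-comm; m+1+n≢m; +-commutativeSemigroup)
open import Data.Fin using (Fin)
open import Data.Product using (_,_; _×_)
open import Data.Sum using (inj₁; inj₂)
open import Data.Bool using (if_then_else_)
open import Relation.Nullary using (¬_)
open import Relation.Binary.PropositionalEquality
open import Algebra.Properties.CommutativeSemigroup +-commutativeSemigroup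
  using (interchange; xy∙z≈xz∙y)

speciesDegree : ∀ {n m} → (Edge n m → ℕ) → Complex n → ℕ
speciesDegree {n} c y = ΣFin n (λ s → if inSupp y s then c (inj₁ s) else 0)

reactionDegree : ∀ {n m} → CRN n m → (Edge n m → ℕ) → Fin m → ℕ
reactionDegree {m = m} N c i =
  ΣFin m (λ j → if memberReaction N j (i , U) then c (inj₂ j) else 0)

+-swap-left-summands : ∀ a b r s → (a + r) + (b + s) ≡ (b + r) + (a + s)
+-swap-left-summands a b r s = begin
  (a + r) + (b + s) ≡⟨ interchange a r b s ⟩
  (a + b) + (r + s) ≡⟨ cong (_+ (r + s)) (+-comm a b) ⟩
  (b + a) + (r + s) ≡⟨ interchange b a r s ⟩
  (b + r) + (a + s) ∎
  where open ≡-Reasoning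

-- Definitionally, deg N c (i , s) is the speciesDegree of the complex at
-- (i , s) plus reactionDegree N c i.
reversible-deg-balance : ∀ {n m} (N : CRN n m) (i j : Fin m) →
  CRN.reactant N j ≡ CRN.product N i → CRN.product N j ≡ CRN.reactant N i →
  ∀ c → deg N c (i , U) + deg N c (j , U) ≡ deg N c (i , V) + deg N c (j , V)
reversible-deg-balance N i j yj≡y'i y'j≡yi c
  rewrite yj≡y'i | y'j≡yi =
  +-swap-left-summands (speciesDegree c (CRN.reactant N i))
    (speciesDegree c (CRN.product N i)) (reactionDegree N c i) (reactionDegree N c j)

¬AlmostBalanced-of-deg-balance : ∀ {n m} (N : CRN n m) (w w′ z z′ : Vertex m) →
  w′ ≢ w → z ≢ w → z′ ≢ w →
  (∀ c → deg N c w + deg N c w′ ≡ deg N c z + deg N c z′) →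
  ¬ AlmostBalanced N w
¬AlmostBalanced-of-deg-balance N w w′ z z′ w′≢w z≢w z′≢w balance
  (r , b , k , s≤s _ , r-excess , r≡b) = m+1+n≢m (dbw + dbw′) excess-vanishes
  where
  dbw = deg N b w
  dbw′ = deg N b w′
  excess-vanishes = begin
    (dbw + dbw′) + k           ≡⟨ xy∙z≈xz∙y dbw k dbw′ ⟨
    (dbw + k) + dbw′           ≡⟨ cong₂ _+_ r-excess (r≡b w′ w′≢w) ⟨
    deg N r w + deg N r w′     ≡⟨ balance r ⟩
    deg N r z + deg N r z′     ≡⟨ cong₂ _+_ (r≡b z z≢w) (r≡b z′ z′≢w) ⟩
    deg N b z + deg N b z′     ≡⟨ balance b ⟨
    dbw + dbw′ ∎
    where open ≡-Reasoning

proposition3p9 : ∀ {n m : ℕ} (N : CRN n m) → IsCRN N →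
    ∀ (i j : Fin m) →
    CRN.reactant N j ≡ CRN.product N i → CRN.product N j ≡ CRN.reactant N i →
    ¬ AlmostBalanced N (i , U) × ¬ AlmostBalanced N (i , V)
      × ¬ AlmostBalanced N (j , U) × ¬ AlmostBalanced N (j , V)
proposition3p9 N isCRN i j yj≡y'i y'j≡yi =
  let ¬u-i , ¬v-i = ends-unbalanced i j yj≡y'i y'j≡yi
      ¬u-j , ¬v-j = ends-unbalanced j i (sym y'j≡yi) (sym yj≡y'i)
  in ¬u-i , ¬v-i , ¬u-j , ¬v-j
  where
  ends-unbalanced : ∀ a b →
    CRN.reactant N b ≡ CRN.product N a → CRN.product N b ≡ CRN.reactant N a →
    ¬ AlmostBalanced N (a , U) × ¬ AlmostBalanced N (a , V)
  ends-unbalanced a b yb≡y'a y'b≡ya =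
      ¬AlmostBalanced-of-deg-balance N (a , U) (b , U) (a , V) (b , V)
        b≢a (λ ()) (λ ()) balance
    , ¬AlmostBalanced-of-deg-balance N (a , V) (b , V) (a , U) (b , U)
        b≢a (λ ()) (λ ()) (λ c → sym (balance c))
    where
    balance = reversible-deg-balance N a b yb≡y'a y'b≡ya
    b≢a : ∀ {s} → (b , s) ≢ (a , s)
    b≢a refl = IsCRN.nonTrivial isCRN a yb≡y'a
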